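{- Let $A$ be a disjunction-free formula of $\mathsf{Form}_{\bot,\supset}$. If $\mathbf{S}_\bot2\vdash A$, then $\mathbf{S}^-_\bot2\vdash A$.
   Context: $\mathsf{Form}_{\bot,\supset}$: formulas built from a countable set $\mathsf{Prop}$ of propositional variables (including distinct $p,q,r$) and the constant $\bot$ using binary connectives $\land,\lor,\to,\supset$; disjunction-free means $\lor$ does not occur. $\mathbf{S}_\bot2$ has the following single axioms (with fixed distinct propositional variables $p,q,r$): (Ax0) $\bot\to p$; (Ax1) $p\to(q\to p)$; (Ax2) $(p\to(q\to r))\to((p\to q)\to(p\to r))$; (Ax3) $(p\land q)\to p$; (Ax4) $(p\land q)\to q$; (Ax5) $(r\to p)\to((r\to q)\to(r\to(p\land q)))$; (Ax6) $p\to(p\lor q)$; (Ax7) $q\to(p\lor q)$; (Ax8) $(p\to r)\to((q\to r)\to((p\lor q)\to r))$; (AxM1) $(p\to q)\supset(p\supset q)$; (AxM2) $(p\supset(q\supset r))\to((p\supset q)\supset(p\supset r))$; (AxM3) $(p\supset(q\to r))\to(q\to(p\supset r))$; (AxM4) $(p\to(q\supset r))\to(q\supset(p\to r))$; (AxM5) $((p\supset q)\supset r)\to((p\supset r)\to r)$; (AxM6') $(p\supset r)\to((q\supset r)\to((p\lor q)\supset r))$; and rules: (MP) from $A$ and $A\supset B$ infer $B$; (Sub) from $A$ infer $A[p/B]$ (uniform substitution of $B$ for all occurrences of a propositional variable $p$). $\mathbf{S}^-_\bot2$ is the same system without the axiom (AxM6'). $\vdash A$ means $A$ is derivable from no assumptions.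 -}

module Defs where

open import Data.Nat using (ℕ; _≟_)
open import Data.Bool using (Bool; true; false)
open import Relation.Nullary using (yes; no)

Prop : Set
Prop = ℕ

data Form : Set where
  var  : Prop → Form
  ⊥'   : Form
  _∧'_ : Form → Form → Form
  _∨'_ : Form → Form → Form
  _⇒_  : Form → Form → Form   -- the connective →
  _⊃_  : Form → Form → Form

infixr 6 _∧'_
infixr 5 _∨'_
infixr 4 _⇒_
infixr 3 _⊃_

p q r : Form
p = var 0
q = var 1
r = var 2

data DisjFree : Form → Set where
  df-var : ∀ x → DisjFree (var x)
  df-⊥   : DisjFree ⊥'
  df-∧   : ∀ {A B} → DisjFree A → DisjFree B → DisjFree (A ∧' B)
  df-⇒   : ∀ {A B} → DisjFree A → DisjFree B → DisjFree (A ⇒ B)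
  df-⊃   : ∀ {A B} → DisjFree A → DisjFree B → DisjFree (A ⊃ B)

_[_/_] : Form → Prop → Form → Form
var y [ x / B ] with y ≟ x
... | yes _ = B
... | no  _ = var y
⊥' [ x / B ] = ⊥'
(C ∧' D) [ x / B ] = (C [ x / B ]) ∧' (D [ x / B ])
(C ∨' D) [ x / B ] = (C [ x / B ]) ∨' (D [ x / B ])
(C ⇒ D) [ x / B ] = (C [ x / B ]) ⇒ (D [ x / B ])
(C ⊃ D) [ x / B ] = (C [ x / B ]) ⊃ (D [ x / B ])

-- Axioms of S_⊥2; the Bool flag says whether AxM6' is available
-- (true: S_⊥2, false: S⁻_⊥2).
data Axiom : Bool → Form → Set where
  ax0  : ∀ {b} → Axiom b (⊥' ⇒ p)
  ax1  : ∀ {b} → Axiom b (p ⇒ (q ⇒ p))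
  ax2  : ∀ {b} → Axiom b ((p ⇒ (q ⇒ r)) ⇒ ((p ⇒ q) ⇒ (p ⇒ r)))
  ax3  : ∀ {b} → Axiom b ((p ∧' q) ⇒ p)
  ax4  : ∀ {b} → Axiom b ((p ∧' q) ⇒ q)
  ax5  : ∀ {b} → Axiom b ((r ⇒ p) ⇒ ((r ⇒ q) ⇒ (r ⇒ (p ∧' q))))
  ax6  : ∀ {b} → Axiom b (p ⇒ (p ∨' q))
  ax7  : ∀ {b} → Axiom b (q ⇒ (p ∨' q))
  ax8  : ∀ {b} → Axiom b ((p ⇒ r) ⇒ ((q ⇒ r) ⇒ ((p ∨' q) ⇒ r)))
  axM1 : ∀ {b} → Axiom b ((p ⇒ q) ⊃ (p ⊃ q))
  axM2 : ∀ {b} → Axiom b ((p ⊃ (q ⊃ r)) ⇒ ((p ⊃ q) ⊃ (p ⊃ r)))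
  axM3 : ∀ {b} → Axiom b ((p ⊃ (q ⇒ r)) ⇒ (q ⇒ (p ⊃ r)))
  axM4 : ∀ {b} → Axiom b ((p ⇒ (q ⊃ r)) ⇒ (q ⊃ (p ⇒ r)))
  axM5 : ∀ {b} → Axiom b (((p ⊃ q) ⊃ r) ⇒ ((p ⊃ r) ⇒ r))
  axM6' : Axiom true ((p ⊃ r) ⇒ ((q ⊃ r) ⇒ ((p ∨' q) ⊃ r)))

data Derivable (b : Bool) : Form → Set where
  axiom : ∀ {A} → Axiom b A → Derivable b A
  mp    : ∀ {A B} → Derivable b A → Derivable b (A ⊃ B) → Derivable b B
  sub   : ∀ {A} (x : Prop) (B : Form) → Derivable b A → Derivable b (A [ x / B ])

S⊥2⊢_ : Form → Set
S⊥2⊢ A = Derivable true A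

S⁻⊥2⊢_ : Form → Set
S⁻⊥2⊢ A = Derivable false A

-- Interpret every formula A, relative to a valuation σ, by a pair of formulas:
-- R A σ, in which each disjunction B ∨ C is read as ¬¬B ∨ ¬¬C with ¬X := X ⊃ ⊥,
-- and T A σ, the reading of A in the consequent of ⊃.  In S⁻⊥2 the ⊃-consequences
-- of a formula are closed under classical case analysis (AxM5 with ⊥ gives
-- excluded middle for ¬), so AxM6' becomes derivable for the ¬¬-disjunction,
-- while R turns every other axiom into a theorem of S⁻⊥2 and commutes with MP
-- (R (A ⊃ B) = R A ⊃ R B) and with substitution.  Hence S⊥2 ⊢ A gives
-- S⁻⊥2 ⊢ R A ι for the identity valuation ι, and for disjunction-free A the
-- formula R A ι is ⊃-equivalent to A.

module Submission where

open import Defs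
open import Data.Nat using (ℕ; suc; _⊔_; _≤_; _<_; _+_; _≟_; s≤s; z≤n)
open import Data.Nat.Properties using (≤-trans; <-irrefl; m≤m⊔n; m≤n⊔m; m⊔n≤o⇒m≤o; m⊔n≤o⇒n≤o; m≤n+m; 1+n≢n; m≢1+n+m)
open import Data.Bool using (true; false)
open import Data.Empty using (⊥-elim)
open import Data.Product using (_×_; _,_; proj₁; proj₂)
open import Relation.Nullary using (yes; no)
open import Relation.Binary.PropositionalEquality

infixl 8 _⟨_⟩

_⟨_⟩ : Form → (Prop → Form) → Form
var y ⟨ ρ ⟩ = ρ y
⊥' ⟨ ρ ⟩ = ⊥'
(A ∧' B) ⟨ ρ ⟩ = A ⟨ ρ ⟩ ∧' B ⟨ ρ ⟩
(A ∨' B) ⟨ ρ ⟩ = A ⟨ ρ ⟩ ∨' B ⟨ ρ ⟩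
(A ⇒ B) ⟨ ρ ⟩ = A ⟨ ρ ⟩ ⇒ B ⟨ ρ ⟩
(A ⊃ B) ⟨ ρ ⟩ = A ⟨ ρ ⟩ ⊃ B ⟨ ρ ⟩

varBound : Form → ℕ
varBound (var y) = suc y
varBound ⊥' = 0
varBound (A ∧' B) = varBound A ⊔ varBound B
varBound (A ∨' B) = varBound A ⊔ varBound B
varBound (A ⇒ B) = varBound A ⊔ varBound B
varBound (A ⊃ B) = varBound A ⊔ varBound B

⟨var⟩ : ∀ A → A ⟨ var ⟩ ≡ A
⟨var⟩ (var x) = refl
⟨var⟩ ⊥' = refl
⟨var⟩ (A ∧' B) = cong₂ _∧'_ (⟨var⟩ A) (⟨var⟩ B)
⟨var⟩ (A ∨' B) = cong₂ _∨'_ (⟨var⟩ A) (⟨var⟩ B)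
⟨var⟩ (A ⇒ B) = cong₂ _⇒_ (⟨var⟩ A) (⟨var⟩ B)
⟨var⟩ (A ⊃ B) = cong₂ _⊃_ (⟨var⟩ A) (⟨var⟩ B)

⟨⟩-[/] : ∀ A ρ x B → (A ⟨ ρ ⟩) [ x / B ] ≡ A ⟨ (λ y → ρ y [ x / B ]) ⟩
⟨⟩-[/] (var y) ρ x B = refl
⟨⟩-[/] ⊥' ρ x B = refl
⟨⟩-[/] (A ∧' C) ρ x B = cong₂ _∧'_ (⟨⟩-[/] A ρ x B) (⟨⟩-[/] C ρ x B)
⟨⟩-[/] (A ∨' C) ρ x B = cong₂ _∨'_ (⟨⟩-[/] A ρ x B) (⟨⟩-[/] C ρ x B)
⟨⟩-[/] (A ⇒ C) ρ x B = cong₂ _⇒_ (⟨⟩-[/] A ρ x B) (⟨⟩-[/] C ρ x B)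
⟨⟩-[/] (A ⊃ C) ρ x B = cong₂ _⊃_ (⟨⟩-[/] A ρ x B) (⟨⟩-[/] C ρ x B)

⟨⟩-cong : ∀ A {n ρ σ} → varBound A ≤ n → (∀ {y} → y < n → ρ y ≡ σ y) → A ⟨ ρ ⟩ ≡ A ⟨ σ ⟩
⟨⟩-cong (var y) bound agree = agree bound
⟨⟩-cong ⊥' bound agree = refl
⟨⟩-cong (A ∧' C) bound agree =
  cong₂ _∧'_ (⟨⟩-cong A (m⊔n≤o⇒m≤o _ _ bound) agree) (⟨⟩-cong C (m⊔n≤o⇒n≤o _ _ bound) agree)
⟨⟩-cong (A ∨' C) bound agree =
  cong₂ _∨'_ (⟨⟩-cong A (m⊔n≤o⇒m≤o _ _ bound) agree) (⟨⟩-cong C (m⊔n≤o⇒n≤o _ _ bound) agree)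
⟨⟩-cong (A ⇒ C) bound agree =
  cong₂ _⇒_ (⟨⟩-cong A (m⊔n≤o⇒m≤o _ _ bound) agree) (⟨⟩-cong C (m⊔n≤o⇒n≤o _ _ bound) agree)
⟨⟩-cong (A ⊃ C) bound agree =
  cong₂ _⊃_ (⟨⟩-cong A (m⊔n≤o⇒m≤o _ _ bound) agree) (⟨⟩-cong C (m⊔n≤o⇒n≤o _ _ bound) agree)

var-[/]-≡ : ∀ x B → var x [ x / B ] ≡ B
var-[/]-≡ x B with x ≟ x
... | yes _ = refl
... | no x≢x = ⊥-elim (x≢x refl)

var-[/]-≢ : ∀ {y x} B → y ≢ x → var y [ x / B ] ≡ var y
var-[/]-≢ {y} {x} B y≢x with y ≟ x
... | yes y≡x = ⊥-elim (y≢x y≡x)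
... | no _ = refl

[/]-fresh : ∀ A {x} B → varBound A ≤ x → A [ x / B ] ≡ A
[/]-fresh (var y) B bound = var-[/]-≢ B (λ { refl → <-irrefl refl bound })
[/]-fresh ⊥' B bound = refl
[/]-fresh (A ∧' C) B bound =
  cong₂ _∧'_ ([/]-fresh A B (m⊔n≤o⇒m≤o _ _ bound)) ([/]-fresh C B (m⊔n≤o⇒n≤o _ _ bound))
[/]-fresh (A ∨' C) B bound =
  cong₂ _∨'_ ([/]-fresh A B (m⊔n≤o⇒m≤o _ _ bound)) ([/]-fresh C B (m⊔n≤o⇒n≤o _ _ bound))
[/]-fresh (A ⇒ C) B bound =
  cong₂ _⇒_ ([/]-fresh A B (m⊔n≤o⇒m≤o _ _ bound)) ([/]-fresh C B (m⊔n≤o⇒n≤o _ _ bound))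
[/]-fresh (A ⊃ C) B bound =
  cong₂ _⊃_ ([/]-fresh A B (m⊔n≤o⇒m≤o _ _ bound)) ([/]-fresh C B (m⊔n≤o⇒n≤o _ _ bound))

Derivable-⟨⟩-[/] : ∀ {b} A {ρ} x B → Derivable b (A ⟨ ρ ⟩) → Derivable b (A ⟨ (λ y → ρ y [ x / B ]) ⟩)
Derivable-⟨⟩-[/] {b} A {ρ} x B d = subst (Derivable b) (⟨⟩-[/] A ρ x B) (sub x B d)

-- Sub only replaces one variable at a time: first move p, q, r to variables
-- x₀, x₁, x₂ that are fresh for σ 0, σ 1, σ 2, then replace those.
module FreshRenaming (σ : Prop → Form) where

  m x₀ x₁ x₂ : ℕ
  m = varBound (σ 0) ⊔ varBound (σ 1) ⊔ varBound (σ 2)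
  x₀ = 3 + m
  x₁ = 4 + m
  x₂ = 5 + m

  toFresh fill : Prop → Form
  toFresh y = ((var y [ 0 / var x₀ ]) [ 1 / var x₁ ]) [ 2 / var x₂ ]
  fill y = ((toFresh y [ x₀ / σ 0 ]) [ x₁ / σ 1 ]) [ x₂ / σ 2 ]

  σ₀≤m : varBound (σ 0) ≤ m
  σ₀≤m = ≤-trans (m≤m⊔n (varBound (σ 0)) _) (m≤m⊔n _ (varBound (σ 2)))

  σ₁≤m : varBound (σ 1) ≤ m
  σ₁≤m = ≤-trans (m≤n⊔m (varBound (σ 0)) _) (m≤m⊔n _ (varBound (σ 2)))

  fill-pqr : ∀ {y} → y < 3 → fill y ≡ σ y
  fill-pqr {0} _ = begin
    ((var x₀ [ x₀ / σ 0 ]) [ x₁ / σ 1 ]) [ x₂ / σ 2 ]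
      ≡⟨ cong (λ C → (C [ x₁ / σ 1 ]) [ x₂ / σ 2 ]) (var-[/]-≡ x₀ (σ 0)) ⟩
    (σ 0 [ x₁ / σ 1 ]) [ x₂ / σ 2 ]
      ≡⟨ cong (_[ x₂ / σ 2 ]) ([/]-fresh (σ 0) (σ 1) (≤-trans σ₀≤m (m≤n+m m 4))) ⟩
    σ 0 [ x₂ / σ 2 ]
      ≡⟨ [/]-fresh (σ 0) (σ 2) (≤-trans σ₀≤m (m≤n+m m 5)) ⟩
    σ 0 ∎
    where open ≡-Reasoning
  fill-pqr {1} _ = begin
    ((var x₁ [ x₀ / σ 0 ]) [ x₁ / σ 1 ]) [ x₂ / σ 2 ]
      ≡⟨ cong (λ C → (C [ x₁ / σ 1 ]) [ x₂ / σ 2 ]) (var-[/]-≢ (σ 0) (1+n≢n {x₀})) ⟩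
    (var x₁ [ x₁ / σ 1 ]) [ x₂ / σ 2 ]
      ≡⟨ cong (_[ x₂ / σ 2 ]) (var-[/]-≡ x₁ (σ 1)) ⟩
    σ 1 [ x₂ / σ 2 ]
      ≡⟨ [/]-fresh (σ 1) (σ 2) (≤-trans σ₁≤m (m≤n+m m 5)) ⟩
    σ 1 ∎
    where open ≡-Reasoning
  fill-pqr {2} _ = begin
    ((var x₂ [ x₀ / σ 0 ]) [ x₁ / σ 1 ]) [ x₂ / σ 2 ]
      ≡⟨ cong (λ C → (C [ x₁ / σ 1 ]) [ x₂ / σ 2 ]) (var-[/]-≢ (σ 0) (≢-sym (m≢1+n+m x₀ {1}))) ⟩
    (var x₂ [ x₁ / σ 1 ]) [ x₂ / σ 2 ]
      ≡⟨ cong (_[ x₂ / σ 2 ]) (var-[/]-≢ (σ 1) (1+n≢n {x₁})) ⟩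
    var x₂ [ x₂ / σ 2 ]
      ≡⟨ var-[/]-≡ x₂ (σ 2) ⟩
    σ 2 ∎
    where open ≡-Reasoning
  fill-pqr {suc (suc (suc _))} (s≤s (s≤s (s≤s ())))

Derivable-⟨⟩ : ∀ {b A} → varBound A ≤ 3 → Derivable b A → ∀ σ → Derivable b (A ⟨ σ ⟩)
Derivable-⟨⟩ {b} {A} bound d σ =
  subst (Derivable b) (⟨⟩-cong A bound fill-pqr)
    (step x₂ (σ 2) (step x₁ (σ 1) (step x₀ (σ 0)
      (step 2 (var x₂) (step 1 (var x₁) (step 0 (var x₀)
        (subst (Derivable b) (sym (⟨var⟩ A)) d)))))))
  where
  open FreshRenaming σ
  step = Derivable-⟨⟩-[/] A

axiom-varBound : ∀ {b A} → Axiom b A → varBound A ≤ 3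
axiom-varBound ax0 = s≤s z≤n
axiom-varBound ax1 = s≤s (s≤s z≤n)
axiom-varBound ax2 = s≤s (s≤s (s≤s z≤n))
axiom-varBound ax3 = s≤s (s≤s z≤n)
axiom-varBound ax4 = s≤s (s≤s z≤n)
axiom-varBound ax5 = s≤s (s≤s (s≤s z≤n))
axiom-varBound ax6 = s≤s (s≤s z≤n)
axiom-varBound ax7 = s≤s (s≤s z≤n)
axiom-varBound ax8 = s≤s (s≤s (s≤s z≤n))
axiom-varBound axM1 = s≤s (s≤s z≤n)
axiom-varBound axM2 = s≤s (s≤s (s≤s z≤n))
axiom-varBound axM3 = s≤s (s≤s (s≤s z≤n))
axiom-varBound axM4 = s≤s (s≤s (s≤s z≤n))
axiom-varBound axM5 = s≤s (s≤s (s≤s z≤n))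
axiom-varBound axM6' = s≤s (s≤s (s≤s z≤n))

-- Natural deduction in S⁻⊥2 under →- and ⊃-hypotheses

infix 1 ⊢_
⊢_ : Form → Set
⊢_ = S⁻⊥2⊢_

pqr : Form → Form → Form → Prop → Form
pqr a b c 0 = a
pqr a b c 1 = b
pqr a b c 2 = c
pqr a b c y = var y

axiom-instance : ∀ {A} → Axiom false A → ∀ a b c → ⊢ A ⟨ pqr a b c ⟩
axiom-instance α a b c = Derivable-⟨⟩ (axiom-varBound α) (axiom α) (pqr a b c)

⊥⇒ : ∀ {A} → ⊢ ⊥' ⇒ A
⊥⇒ {A} = axiom-instance ax0 A ⊥' ⊥'

K : ∀ {A B} → ⊢ A ⇒ (B ⇒ A)
K {A} {B} = axiom-instance ax1 A B ⊥'

S : ∀ {A B C} → ⊢ (A ⇒ (B ⇒ C)) ⇒ ((A ⇒ B) ⇒ (A ⇒ C))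
S {A} {B} {C} = axiom-instance ax2 A B C

∧-π₁ : ∀ {A B} → ⊢ (A ∧' B) ⇒ A
∧-π₁ {A} {B} = axiom-instance ax3 A B ⊥'

∧-π₂ : ∀ {A B} → ⊢ (A ∧' B) ⇒ B
∧-π₂ {A} {B} = axiom-instance ax4 A B ⊥'

∧-⟨,⟩ : ∀ {A B C} → ⊢ (C ⇒ A) ⇒ ((C ⇒ B) ⇒ (C ⇒ (A ∧' B)))
∧-⟨,⟩ {A} {B} {C} = axiom-instance ax5 A B C

∨-ι₁ : ∀ {A B} → ⊢ A ⇒ (A ∨' B)
∨-ι₁ {A} {B} = axiom-instance ax6 A B ⊥'

∨-ι₂ : ∀ {A B} → ⊢ B ⇒ (A ∨' B)
∨-ι₂ {A} {B} = axiom-instance ax7 A B ⊥'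

∨-[,] : ∀ {A B C} → ⊢ (A ⇒ C) ⇒ ((B ⇒ C) ⇒ ((A ∨' B) ⇒ C))
∨-[,] {A} {B} {C} = axiom-instance ax8 A B C

⇒-⊃ : ∀ {A B} → ⊢ (A ⇒ B) ⊃ (A ⊃ B)
⇒-⊃ {A} {B} = axiom-instance axM1 A B ⊥'

⊃-S : ∀ {A B C} → ⊢ (A ⊃ (B ⊃ C)) ⇒ ((A ⊃ B) ⊃ (A ⊃ C))
⊃-S {A} {B} {C} = axiom-instance axM2 A B C

⊃⇒-exchange : ∀ {A B C} → ⊢ (A ⊃ (B ⇒ C)) ⇒ (B ⇒ (A ⊃ C))
⊃⇒-exchange {A} {B} {C} = axiom-instance axM3 A B C

⇒⊃-exchange : ∀ {A B C} → ⊢ (A ⇒ (B ⊃ C)) ⇒ (B ⊃ (A ⇒ C))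
⇒⊃-exchange {A} {B} {C} = axiom-instance axM4 A B C

⊃-cases : ∀ {A B C} → ⊢ ((A ⊃ B) ⊃ C) ⇒ ((A ⊃ C) ⇒ C)
⊃-cases {A} {B} {C} = axiom-instance axM5 A B C

mp⇒ : ∀ {A B} → ⊢ A ⇒ B → ⊢ A → ⊢ B
mp⇒ f a = mp a (mp f ⇒-⊃)

I⇒ : ∀ {A} → ⊢ A ⇒ A
I⇒ {A} = mp⇒ (mp⇒ S K) (K {B = A})

I⊃ : ∀ {A} → ⊢ A ⊃ A
I⊃ = mp I⇒ ⇒-⊃

nec : ∀ {A B} → ⊢ B → ⊢ A ⊃ B
nec b = mp (mp⇒ K b) ⇒-⊃

K⊃ : ∀ {A B} → ⊢ A ⊃ (B ⊃ A)
K⊃ = mp (mp⇒ ⊃⇒-exchange (nec I⇒)) ⇒-⊃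

⊃-eval : ∀ {A B} → ⊢ A ⊃ ((A ⊃ B) ⇒ B)
⊃-eval = mp⇒ ⇒⊃-exchange I⇒

infixl 1 _▸_

data Ctx : Set where
  ∅ : Ctx
  _▸_ : Ctx → Form → Ctx

_⇒*_ : Ctx → Form → Form
∅ ⇒* A = A
(Γ ▸ G) ⇒* A = Γ ⇒* (G ⇒ A)

_⊃*_ : Ctx → Form → Form
∅ ⊃* A = A
(Γ ▸ G) ⊃* A = Γ ⊃* (G ⊃ A)

infix 0 _⊢⇒_ _⊢⊃_

-- Records rather than plain synonyms, so that Γ and A can be inferred.
record _⊢⇒_ (Γ : Ctx) (A : Form) : Set where
  constructor derive⇒
  field discharge⇒ : ⊢ Γ ⇒* A
open _⊢⇒_

record _⊢⊃_ (Γ : Ctx) (A : Form) : Set where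
  constructor derive⊃
  field discharge⊃ : ⊢ Γ ⊃* A
open _⊢⊃_

module _ {Γ : Ctx} {A B : Form} where

  lam⇒ : Γ ▸ A ⊢⇒ B → Γ ⊢⇒ A ⇒ B
  lam⇒ (derive⇒ d) = derive⇒ d

  unlam⇒ : Γ ⊢⇒ A ⇒ B → Γ ▸ A ⊢⇒ B
  unlam⇒ (derive⇒ d) = derive⇒ d

  lam⊃ : Γ ▸ A ⊢⊃ B → Γ ⊢⊃ A ⊃ B
  lam⊃ (derive⊃ d) = derive⊃ d

  unlam⊃ : Γ ⊢⊃ A ⊃ B → Γ ▸ A ⊢⊃ B
  unlam⊃ (derive⊃ d) = derive⊃ d

const⇒ : ∀ {Γ A} → ⊢ A → Γ ⊢⇒ A
const⇒ {∅} a = derive⇒ a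
const⇒ {Γ ▸ G} a = unlam⇒ (const⇒ (mp⇒ K a))

infixl 6 _·_

_·_ : ∀ {Γ A B} → Γ ⊢⇒ A ⇒ B → Γ ⊢⇒ A → Γ ⊢⇒ B
_·_ {∅} f a = derive⇒ (mp⇒ (discharge⇒ f) (discharge⇒ a))
_·_ {Γ ▸ G} f a = unlam⇒ (const⇒ S · lam⇒ f · lam⇒ a)

hyp⇒ : ∀ {Γ A} → Γ ▸ A ⊢⇒ A
hyp⇒ = unlam⇒ (const⇒ I⇒)

wk⇒ : ∀ {Γ A B} → Γ ⊢⇒ A → Γ ▸ B ⊢⇒ A
wk⇒ a = unlam⇒ (const⇒ K · a)

const⊃ : ∀ {Γ A} → ⊢ A → Γ ⊢⊃ A
const⊃ {∅} a = derive⊃ a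
const⊃ {Γ ▸ G} a = unlam⊃ (const⊃ (nec a))

infixl 6 _⊃·_ _⇒·_

_⊃·_ : ∀ {Γ A B} → Γ ⊢⊃ A ⊃ B → Γ ⊢⊃ A → Γ ⊢⊃ B
_⇒·_ : ∀ {Γ A B} → Γ ⊢⊃ A ⇒ B → Γ ⊢⊃ A → Γ ⊢⊃ B
_⊃·_ {∅} f a = derive⊃ (mp (discharge⊃ a) (discharge⊃ f))
_⊃·_ {Γ ▸ G} f a = unlam⊃ (const⊃ ⊃-S ⇒· lam⊃ f ⊃· lam⊃ a)
f ⇒· a = const⊃ ⇒-⊃ ⊃· f ⊃· a

hyp⊃ : ∀ {Γ A} → Γ ▸ A ⊢⊃ A
hyp⊃ = unlam⊃ (const⊃ I⊃)

wk⊃ : ∀ {Γ A B} → Γ ⊢⊃ A → Γ ▸ B ⊢⊃ A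
wk⊃ a = unlam⊃ (const⊃ K⊃ ⊃· a)

#0 : ∀ {Γ A} → Γ ▸ A ⊢⊃ A
#0 = hyp⊃

#1 : ∀ {Γ A B} → Γ ▸ A ▸ B ⊢⊃ A
#1 = wk⊃ #0

#2 : ∀ {Γ A B C} → Γ ▸ A ▸ B ▸ C ⊢⊃ A
#2 = wk⊃ #1

#3 : ∀ {Γ A B C D} → Γ ▸ A ▸ B ▸ C ▸ D ⊢⊃ A
#3 = wk⊃ #2

⊃-intro : ∀ {A B} → ∅ ▸ A ⊢⊃ B → ⊢ A ⊃ B
⊃-intro = discharge⊃

∧-intro : ∀ {A B} → ⊢ A ⇒ (B ⇒ (A ∧' B))
∧-intro {A} {B} = discharge⇒ pairing
  where
  pairing : ∅ ▸ A ▸ B ⊢⇒ A ∧' B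
  pairing = const⇒ (∧-⟨,⟩ {C = ⊥' ⇒ ⊥'}) · (const⇒ K · wk⇒ hyp⇒) · (const⇒ K · hyp⇒) · const⇒ I⇒

⇒-comp : ∀ {A B C} → ⊢ (A ⇒ B) ⇒ ((B ⇒ C) ⇒ (A ⇒ C))
⇒-comp {A} {B} {C} = discharge⇒ composite
  where
  composite : ∅ ▸ A ⇒ B ▸ B ⇒ C ▸ A ⊢⇒ C
  composite = wk⇒ hyp⇒ · (wk⇒ (wk⇒ hyp⇒) · hyp⇒)

∧-mono⇒ : ∀ {A A' B B'} → ⊢ A ⇒ A' → ⊢ B ⇒ B' → ⊢ (A ∧' B) ⇒ (A' ∧' B')
∧-mono⇒ {A} {A'} {B} {B'} f g = discharge⇒ mapped
  where
  mapped : ∅ ▸ A ∧' B ⊢⇒ A' ∧' B'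
  mapped = const⇒ ∧-intro · (const⇒ f · (const⇒ ∧-π₁ · hyp⇒)) · (const⇒ g · (const⇒ ∧-π₂ · hyp⇒))

⇒-mono⇒ : ∀ {A A' B B'} → ⊢ A' ⇒ A → ⊢ B ⇒ B' → ⊢ (A ⇒ B) ⇒ (A' ⇒ B')
⇒-mono⇒ {A} {A'} {B} {B'} f g = discharge⇒ mapped
  where
  mapped : ∅ ▸ A ⇒ B ▸ A' ⊢⇒ B'
  mapped = const⇒ g · (wk⇒ hyp⇒ · (const⇒ f · hyp⇒))

⇒-trans⊃ : ∀ {Γ A B C} → Γ ⊢⊃ A ⇒ B → Γ ⊢⊃ B ⇒ C → Γ ⊢⊃ A ⇒ C
⇒-trans⊃ f g = const⊃ ⇒-comp ⇒· f ⇒· g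

pair⊃ : ∀ {Γ A B} → Γ ⊢⊃ A → Γ ⊢⊃ B → Γ ⊢⊃ A ∧' B
pair⊃ a b = const⊃ ∧-intro ⇒· a ⇒· b

fst⊃ : ∀ {Γ A B} → Γ ⊢⊃ A ∧' B → Γ ⊢⊃ A
fst⊃ = const⊃ ∧-π₁ ⇒·_

snd⊃ : ∀ {Γ A B} → Γ ⊢⊃ A ∧' B → Γ ⊢⊃ B
snd⊃ = const⊃ ∧-π₂ ⇒·_

⊥-elim⊃ : ∀ {Γ A} → Γ ⊢⊃ ⊥' → Γ ⊢⊃ A
⊥-elim⊃ = const⊃ ⊥⇒ ⇒·_

eval⊃ : ∀ {Γ A B} → Γ ⊢⊃ A → Γ ⊢⊃ (A ⊃ B) ⇒ B
eval⊃ a = const⊃ ⊃-eval ⊃· a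

-- AxM5 with B = ⊥' is excluded middle for the negation A ⊃ ⊥'.
cases⊃ : ∀ {Γ A C} → Γ ▸ A ⊢⊃ C → Γ ▸ (A ⊃ ⊥') ⊢⊃ C → Γ ⊢⊃ C
cases⊃ onA onNotA = const⊃ ⊃-cases ⇒· lam⊃ onNotA ⇒· lam⊃ onA

¬-elim⊃ : ∀ {Γ A B} → Γ ⊢⊃ A ⊃ ⊥' → Γ ⊢⊃ A ⊃ B
¬-elim⊃ notA = lam⊃ (⊥-elim⊃ (wk⊃ notA ⊃· #0))

¬¬_ : Form → Form
¬¬ A = (A ⊃ ⊥') ⊃ ⊥'

¬¬-intro⊃ : ∀ {Γ A} → Γ ⊢⊃ A → Γ ⊢⊃ ¬¬ A
¬¬-intro⊃ a = lam⊃ (#0 ⊃· wk⊃ a)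

¬¬∨-elim⊃ : ∀ {Γ A B C} → Γ ⊢⊃ ¬¬ A ∨' ¬¬ B → Γ ▸ A ⊢⊃ C → Γ ▸ B ⊢⊃ C → Γ ⊢⊃ C
¬¬∨-elim⊃ {Γ} {A} {B} d onA onB = cases⊃ onA (cases⊃ (unlam⊃ (wk⊃ (lam⊃ onB))) (⊥-elim⊃ absurd))
  where
  absurd : Γ ▸ (A ⊃ ⊥') ▸ (B ⊃ ⊥') ⊢⊃ ⊥'
  absurd = const⊃ ∨-[,] ⇒· eval⊃ #1 ⇒· eval⊃ #0 ⇒· wk⊃ (wk⊃ d)

-- AxM6' for the disjunction as translated by R.
¬¬∨-⊃-elim : ∀ {A B C} → ⊢ (A ⊃ C) ⇒ ((B ⊃ C) ⇒ ((¬¬ A ∨' ¬¬ B) ⊃ C))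
¬¬∨-⊃-elim {A} {B} {C} = ⇒-trans (mp⇒ ⊃⇒-exchange (⊃-intro byCases)) ⊃⇒-exchange
  where
  ⇒-trans : ∀ {X Y Z} → ⊢ X ⇒ Y → ⊢ Y ⇒ Z → ⊢ X ⇒ Z
  ⇒-trans f g = discharge⊃ {∅} (⇒-trans⊃ (const⊃ f) (const⊃ g))
  byCases : ∅ ▸ ¬¬ A ∨' ¬¬ B ⊢⊃ (A ⊃ C) ⇒ ((B ⊃ C) ⇒ C)
  byCases = ¬¬∨-elim⊃ #0 (⇒-trans⊃ (eval⊃ #0) (const⊃ K)) (const⊃ K ⇒· eval⊃ #0)

∧-mono⊃ : ∀ {A A' B B'} → ⊢ A ⊃ A' → ⊢ B ⊃ B' → ⊢ (A ∧' B) ⊃ (A' ∧' B')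
∧-mono⊃ f g = ⊃-intro (pair⊃ (const⊃ f ⊃· fst⊃ #0) (const⊃ g ⊃· snd⊃ #0))

⊃-mono⊃ : ∀ {A A' B B'} → ⊢ A' ⊃ A → ⊢ B ⊃ B' → ⊢ (A ⊃ B) ⊃ (A' ⊃ B')
⊃-mono⊃ f g = ⊃-intro (lam⊃ (const⊃ g ⊃· (#1 ⊃· (const⊃ f ⊃· #0))))

⊃-mono⇒ : ∀ {A A' B B'} → ⊢ A' ⊃ A → ⊢ B ⇒ B' → ⊢ (A ⊃ B) ⇒ (A' ⊃ B')
⊃-mono⇒ f g = mp⇒ ⊃⇒-exchange (⊃-intro (⇒-trans⊃ (eval⊃ (const⊃ f ⊃· #0)) (const⊃ g)))

-- The translation

Val : Set
Val = Prop → Form × Form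

T R : Form → Val → Form
T (var y) σ = proj₁ (σ y)
T ⊥' σ = ⊥'
T (A ∧' B) σ = T A σ ∧' T B σ
T (A ∨' B) σ = T A σ ∨' T B σ
T (A ⇒ B) σ = T A σ ⇒ T B σ
T (A ⊃ B) σ = R A σ ⊃ T B σ
R (var y) σ = proj₂ (σ y)
R ⊥' σ = ⊥'
R (A ∧' B) σ = R A σ ∧' R B σ
R (A ∨' B) σ = ¬¬ R A σ ∨' ¬¬ R B σ
R (A ⇒ B) σ = (R A σ ⊃ R B σ) ∧' (T A σ ⇒ T B σ)
R (A ⊃ B) σ = R A σ ⊃ R B σ

_[_↦_] : Val → Prop → Form → Val
(σ [ x ↦ B ]) y = T (var y [ x / B ]) σ , R (var y [ x / B ]) σ

T-[/] : ∀ A {x B σ} → T (A [ x / B ]) σ ≡ T A (σ [ x ↦ B ])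
R-[/] : ∀ A {x B σ} → R (A [ x / B ]) σ ≡ R A (σ [ x ↦ B ])
T-[/] (var y) = refl
T-[/] ⊥' = refl
T-[/] (A ∧' C) = cong₂ _∧'_ (T-[/] A) (T-[/] C)
T-[/] (A ∨' C) = cong₂ _∨'_ (T-[/] A) (T-[/] C)
T-[/] (A ⇒ C) = cong₂ _⇒_ (T-[/] A) (T-[/] C)
T-[/] (A ⊃ C) = cong₂ _⊃_ (R-[/] A) (T-[/] C)
R-[/] (var y) = refl
R-[/] ⊥' = refl
R-[/] (A ∧' C) = cong₂ _∧'_ (R-[/] A) (R-[/] C)
R-[/] (A ∨' C) = cong₂ (λ X Y → ¬¬ X ∨' ¬¬ Y) (R-[/] A) (R-[/] C)
R-[/] (A ⇒ C) = cong₂ _∧'_ (cong₂ _⊃_ (R-[/] A) (R-[/] C)) (cong₂ _⇒_ (T-[/] A) (T-[/] C))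
R-[/] (A ⊃ C) = cong₂ _⊃_ (R-[/] A) (R-[/] C)

Coherent : Val → Set
Coherent σ = ∀ y → ⊢ R (var y) σ ⊃ T (var y) σ

R⊃T : ∀ {σ} → Coherent σ → ∀ A → ⊢ R A σ ⊃ T A σ
R⊃T c (var y) = c y
R⊃T c ⊥' = I⊃
R⊃T c (A ∧' B) = ∧-mono⊃ (R⊃T c A) (R⊃T c B)
R⊃T c (A ∨' B) = ⊃-intro (¬¬∨-elim⊃ #0
  (const⊃ ∨-ι₁ ⇒· (const⊃ (R⊃T c A) ⊃· #0))
  (const⊃ ∨-ι₂ ⇒· (const⊃ (R⊃T c B) ⊃· #0)))
R⊃T c (A ⇒ B) = ⊃-intro (snd⊃ #0)
R⊃T c (A ⊃ B) = ⊃-mono⊃ I⊃ (R⊃T c B)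

coherent-[↦] : ∀ {σ} → Coherent σ → ∀ x B → Coherent (σ [ x ↦ B ])
coherent-[↦] c x B y = R⊃T c (var y [ x / B ])

R⇒-intro : ∀ {Γ A A' B B'} → Γ ▸ A' ⊢⊃ B' → Γ ⊢⊃ A ⇒ B → Γ ⊢⊃ (A' ⊃ B') ∧' (A ⇒ B)
R⇒-intro onR onT = pair⊃ (lam⊃ onR) onT

module _ {σ : Val} (c : Coherent σ) where

  axiom-sound : ∀ {A} → Axiom true A → ∅ ⊢⊃ R A σ
  axiom-sound ax0 = R⇒-intro (⊥-elim⊃ #0) (const⊃ ⊥⇒)
  axiom-sound ax1 = R⇒-intro (R⇒-intro #1 (const⊃ K ⇒· (const⊃ (c 0) ⊃· #0))) (const⊃ K)
  axiom-sound ax2 = R⇒-intro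
    (R⇒-intro (R⇒-intro (fst⊃ (fst⊃ #2 ⊃· #0) ⊃· (fst⊃ #1 ⊃· #0))
                        (const⊃ S ⇒· snd⊃ #1 ⇒· snd⊃ #0))
              (const⊃ S ⇒· snd⊃ #0))
    (const⊃ S)
  axiom-sound ax3 = R⇒-intro (fst⊃ #0) (const⊃ ∧-π₁)
  axiom-sound ax4 = R⇒-intro (snd⊃ #0) (const⊃ ∧-π₂)
  axiom-sound ax5 = R⇒-intro
    (R⇒-intro (R⇒-intro (pair⊃ (fst⊃ #2 ⊃· #0) (fst⊃ #1 ⊃· #0))
                        (const⊃ ∧-⟨,⟩ ⇒· snd⊃ #1 ⇒· snd⊃ #0))
              (const⊃ ∧-⟨,⟩ ⇒· snd⊃ #0))
    (const⊃ ∧-⟨,⟩)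
  axiom-sound ax6 = R⇒-intro (const⊃ ∨-ι₁ ⇒· ¬¬-intro⊃ #0) (const⊃ ∨-ι₁)
  axiom-sound ax7 = R⇒-intro (const⊃ ∨-ι₂ ⇒· ¬¬-intro⊃ #0) (const⊃ ∨-ι₂)
  axiom-sound ax8 = R⇒-intro
    (R⇒-intro (R⇒-intro (¬¬∨-elim⊃ #0 (fst⊃ #3 ⊃· #0) (fst⊃ #2 ⊃· #0))
                        (const⊃ ∨-[,] ⇒· snd⊃ #1 ⇒· snd⊃ #0))
              (const⊃ ∨-[,] ⇒· snd⊃ #0))
    (const⊃ ∨-[,])
  axiom-sound axM1 = lam⊃ (fst⊃ #0)
  axiom-sound axM2 = R⇒-intro (lam⊃ (lam⊃ (#2 ⊃· #0 ⊃· (#1 ⊃· #0)))) (const⊃ ⊃-S)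
  axiom-sound axM3 = R⇒-intro
    (R⇒-intro (lam⊃ (fst⊃ (#2 ⊃· #0) ⊃· #1))
              (const⊃ ⊃⇒-exchange ⇒· lam⊃ (snd⊃ (#1 ⊃· #0))))
    (const⊃ ⊃⇒-exchange)
  axiom-sound axM4 = R⇒-intro
    (lam⊃ (R⇒-intro (fst⊃ #2 ⊃· #0 ⊃· #1) (const⊃ ⇒⊃-exchange ⇒· snd⊃ #1 ⊃· #0)))
    (const⊃ ⇒⊃-exchange)
  axiom-sound axM5 = R⇒-intro
    (R⇒-intro (cases⊃ (#1 ⊃· #0) (#2 ⊃· ¬-elim⊃ #0))
              (const⊃ ⊃-cases ⇒· lam⊃ (const⊃ (c 2) ⊃· (#1 ⊃· ¬-elim⊃ #0))))
    (const⊃ ⊃-cases)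
  axiom-sound axM6' = R⇒-intro
    (R⇒-intro (lam⊃ (¬¬∨-elim⊃ #0 (#3 ⊃· #0) (#2 ⊃· #0)))
              (const⊃ ¬¬∨-⊃-elim ⇒· lam⊃ (const⊃ (c 2) ⊃· (#1 ⊃· #0))))
    (const⊃ ¬¬∨-⊃-elim)

sound : ∀ {A} → S⊥2⊢ A → ∀ {σ} → Coherent σ → ∅ ⊢⊃ R A σ
sound (axiom α) c = axiom-sound c α
sound (mp d e) c = sound e c ⊃· sound d c
sound (sub {A} x B d) c = subst (∅ ⊢⊃_) (sym (R-[/] A)) (sound d (coherent-[↦] c x B))

ι : Val
ι y = var y , var y

ι-coherent : Coherent ι
ι-coherent y = I⊃

record Faithful (A : Form) : Set where
  field
    T⇒ : ⊢ T A ι ⇒ A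
    ⇒T : ⊢ A ⇒ T A ι
    R⊃ : ⊢ R A ι ⊃ A
    ⊃R : ⊢ A ⊃ R A ι
open Faithful

disjFree-faithful : ∀ {A} → DisjFree A → Faithful A
disjFree-faithful (df-var x) = record { T⇒ = I⇒ ; ⇒T = I⇒ ; R⊃ = I⊃ ; ⊃R = I⊃ }
disjFree-faithful df-⊥ = record { T⇒ = I⇒ ; ⇒T = I⇒ ; R⊃ = I⊃ ; ⊃R = I⊃ }
disjFree-faithful (df-∧ dA dB) = record
  { T⇒ = ∧-mono⇒ (T⇒ a) (T⇒ b)
  ; ⇒T = ∧-mono⇒ (⇒T a) (⇒T b)
  ; R⊃ = ∧-mono⊃ (R⊃ a) (R⊃ b)
  ; ⊃R = ∧-mono⊃ (⊃R a) (⊃R b)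
  }
  where
  a = disjFree-faithful dA
  b = disjFree-faithful dB
disjFree-faithful (df-⇒ dA dB) = record
  { T⇒ = ⇒-mono⇒ (⇒T a) (T⇒ b)
  ; ⇒T = ⇒-mono⇒ (T⇒ a) (⇒T b)
  ; R⊃ = ⊃-intro (const⊃ (⇒-mono⇒ (⇒T a) (T⇒ b)) ⇒· snd⊃ #0)
  ; ⊃R = ⊃-intro (pair⊃ (lam⊃ (const⊃ (⊃R b) ⊃· (#1 ⇒· (const⊃ (R⊃ a) ⊃· #0))))
                        (const⊃ (⇒-mono⇒ (T⇒ a) (⇒T b)) ⇒· #0))
  }
  where
  a = disjFree-faithful dA
  b = disjFree-faithful dB
disjFree-faithful (df-⊃ dA dB) = record
  { T⇒ = ⊃-mono⇒ (⊃R a) (T⇒ b)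
  ; ⇒T = ⊃-mono⇒ (R⊃ a) (⇒T b)
  ; R⊃ = ⊃-mono⊃ (⊃R a) (R⊃ b)
  ; ⊃R = ⊃-mono⊃ (R⊃ a) (⊃R b)
  }
  where
  a = disjFree-faithful dA
  b = disjFree-faithful dB

mainTheorem15 : (A : Form) → DisjFree A → S⊥2⊢ A → S⁻⊥2⊢ A
mainTheorem15 A disjFree ⊢A = discharge⊃ (const⊃ (R⊃ (disjFree-faithful disjFree)) ⊃· sound ⊢A ι-coherent)
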